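{- For any graph $G$ of order $n$ and any positive integer $t$, $\omega(S(G,t))=\omega(G)$, where $\omega$ denotes the clique number (the maximum number of vertices of a complete subgraph).
   Context: For a graph $G=(V,E)$ and a positive integer $t$, $V^t$ denotes the set of words $u=u_1u_2\cdots u_t$ of length $t$ over the alphabet $V$. The generalized Sierpiński graph $S(G,t)$ has vertex set $V^t$, and $\{u,v\}$ is an edge if and only if there is $i\in\{1,\dots,t\}$ such that: (i) $u_j=v_j$ for all $j<i$; (ii) $u_i\ne v_i$ and $\{u_i,v_i\}\in E$; (iii) $u_j=v_i$ and $v_j=u_i$ for all $j>i$. Graphs are finite, simple and non-empty. -}

module Defs where

open import Data.Nat using (ℕ; _≤_)
open import Data.Fin using (Fin; _<_)
open import Data.Vec using (Vec; lookup)
open import Data.Product using (Σ; ∃; _×_)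
open import Relation.Binary.PropositionalEquality using (_≡_; _≢_)
open import Relation.Nullary using (¬_)
open import Function.Definitions using (Injective)
open import Level using (0ℓ; suc)

record Graph (V : Set) : Set₁ where
  field
    Adj : V → V → Set

open Graph public

record IsSimple {V : Set} (G : Graph V) : Set where
  field
    sym    : ∀ {x y} → Adj G x y → Adj G y x
    irrefl : ∀ x → ¬ Adj G x x

-- Edge condition of S(G,t) at position i (positions are Fin t, i.e. 0-based).
SierpinskiAdjAt : ∀ {n t} → Graph (Fin n) → Vec (Fin n) t → Vec (Fin n) t → Fin t → Set
SierpinskiAdjAt G u v i =
  (∀ j → j < i → lookup u j ≡ lookup v j)
  × (lookup u i ≢ lookup v i)
  × Adj G (lookup u i) (lookup v i)
  × (∀ j → i < j → (lookup u j ≡ lookup v i) × (lookup v j ≡ lookup u i))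

Sierpinski : ∀ {n} → Graph (Fin n) → (t : ℕ) → Graph (Vec (Fin n) t)
Sierpinski G t = record { Adj = λ u v → ∃ λ (i : Fin t) → SierpinskiAdjAt G u v i }

record Clique {V : Set} (G : Graph V) (k : ℕ) : Set where
  field
    vertex   : Fin k → V
    distinct : Injective _≡_ _≡_ vertex
    adjacent : ∀ i j → i ≢ j → Adj G (vertex i) (vertex j)

CliqueNumber : {V : Set} → Graph V → ℕ → Set
CliqueNumber G k = Clique G k × (∀ m → Clique G m → m ≤ k)

module Submission where

-- The two inequalities are proved by transporting cliques in both directions.
--
-- * From S(G,t) to G.  The position i of an edge {u,v} of S(G,t) is the first
--   coordinate where u and v differ, so it is determined by the edge.  In a
--   triangle u,v,w the edges uv and uw have the same position; hence all edges
--   of a clique with at least two vertices share one position p, and the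
--   letters at p of its vertices form a clique of the same size in G.
--   Cliques with fewer than two vertices exist in G because G is non-empty.
--
-- * From G to S(G,t).  Fix a letter c; the words c…c x (x in the last
--   coordinate) span a copy of G inside S(G,t), so every clique of G lifts.
--
-- Finally, two graphs with the same clique sizes have the same clique number.

open import Defs
open import Data.Nat using (ℕ; _≤_; zero; suc; s≤s)
open import Data.Nat.Properties using (<-trans; ≤⇒≯)
open import Data.Fin using (Fin; fromℕ; _<_) renaming (zero to fz; suc to fs)
open import Data.Fin.Properties using (_≟_; <-cmp; ≤fromℕ)
open import Data.Vec using (Vec; lookup; []; _∷_)
open import Data.Product using (_,_; proj₁; proj₂)
open import Data.Empty using (⊥; ⊥-elim)
open import Relation.Nullary using (¬_; yes; no)
open import Relation.Binary.PropositionalEquality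
  using (_≡_; _≢_; refl; sym; trans; cong; subst; subst₂; ≢-sym; module ≡-Reasoning)
open import Relation.Binary.Definitions using (tri<; tri≈; tri>)
open import Function.Base using (_∘_)
open import Function.Bundles using (_⇔_; mk⇔)

cliqueNumber-transfer : {V W : Set} (A : Graph V) (B : Graph W) →
  (∀ m → Clique A m → Clique B m) → (∀ m → Clique B m → Clique A m) →
  ∀ k → CliqueNumber A k ⇔ CliqueNumber B k
cliqueNumber-transfer A B A→B B→A k = mk⇔
  (λ (c , maximal) → A→B k c , λ m d → maximal m (B→A m d))
  (λ (c , maximal) → B→A k c , λ m d → maximal m (A→B m d))

emptyClique : {V : Set} (G : Graph V) → Clique G 0
emptyClique G = record { vertex = λ () ; distinct = λ {x} → ⊥-elim (noFin0 x) ; adjacent = λ () }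
  where
    noFin0 : Fin 0 → ⊥
    noFin0 ()

singletonClique : {V : Set} (G : Graph V) → V → Clique G 1
singletonClique G x = record
  { vertex = λ _ → x ; distinct = λ {i} {j} _ → only i j ; adjacent = λ i j i≢j → ⊥-elim (i≢j (only i j)) }
  where
    only : (i j : Fin 1) → i ≡ j
    only fz fz = refl

record FirstDifference {A : Set} {t : ℕ} (u v : Vec A t) (i : Fin t) : Set where
  constructor firstDifference
  field
    agree  : ∀ j → j < i → lookup u j ≡ lookup v j
    differ : lookup u i ≢ lookup v i

firstDifference-unique : {A : Set} {t : ℕ} {u v : Vec A t} {i i′ : Fin t} →
  FirstDifference u v i → FirstDifference u v i′ → i ≡ i′
firstDifference-unique {i = i} {i′} (firstDifference agree differ) (firstDifference agree′ differ′) with <-cmp i i′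
... | tri< i<i′ _ _ = ⊥-elim (differ (agree′ i i<i′))
... | tri≈ _ i≡i′ _ = i≡i′
... | tri> _ _ i′<i = ⊥-elim (differ′ (agree i′ i′<i))

firstDifference-sym : {A : Set} {t : ℕ} {u v : Vec A t} {i : Fin t} →
  FirstDifference u v i → FirstDifference v u i
firstDifference-sym (firstDifference agree differ) =
  firstDifference (λ j j<i → sym (agree j j<i)) (λ e → differ (sym e))

module Positions {n t : ℕ} (G : Graph (Fin n)) where

  Word : Set
  Word = Vec (Fin n) t

  edge-firstDifference : ∀ {u v : Word} {i} → SierpinskiAdjAt G u v i → FirstDifference u v i
  edge-firstDifference (agree , differ , _) = firstDifference agree differ

  position-unique : ∀ {u v : Word} {i i′} → SierpinskiAdjAt G u v i → SierpinskiAdjAt G u v i′ → i ≡ i′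
  position-unique {u} {v} e e′ =
    firstDifference-unique (edge-firstDifference {u} {v} e) (edge-firstDifference {u} {v} e′)

  position-flip : ∀ {u v : Word} {i i′} → SierpinskiAdjAt G u v i → SierpinskiAdjAt G v u i′ → i ≡ i′
  position-flip {u} {v} e e′ =
    firstDifference-unique (edge-firstDifference {u} {v} e)
                           (firstDifference-sym (edge-firstDifference {v} {u} e′))

  -- In a triangle u,v,w the edge uv cannot sit strictly before the edge uw:
  -- compare with the position of vw and find two coordinates that must agree.
  triangle-not-before : ∀ {u v w : Word} {i i′ i″} →
    SierpinskiAdjAt G u v i → SierpinskiAdjAt G u w i′ → SierpinskiAdjAt G v w i″ → ¬ (i < i′)
  triangle-not-before {u} {v} {w} {i} {i′} {i″}
    (agree , differ , _ , tail) (agree′ , differ′ , _ , _) (agree″ , differ″ , _ , tail″) i<i′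
    with <-cmp i″ i
  ... | tri< i″<i _ _ = differ″ (trans (sym (agree i″ i″<i)) (agree′ i″ (<-trans i″<i i<i′)))
  ... | tri> _ _ i<i″ = differ (trans (agree′ i i<i′) (sym (agree″ i i<i″)))
  ... | tri≈ _ refl _ = differ′ (trans (proj₁ (tail i′ i<i′)) (sym (proj₂ (tail″ i′ i<i′))))

  triangle-position : ∀ {u v w : Word} {i i′ i″ i‴} →
    SierpinskiAdjAt G u v i → SierpinskiAdjAt G u w i′ →
    SierpinskiAdjAt G v w i″ → SierpinskiAdjAt G w v i‴ → i ≡ i′
  triangle-position {u} {v} {w} {i} {i′} uv uw vw wv with <-cmp i i′
  ... | tri< i<i′ _ _ = ⊥-elim (triangle-not-before {u} {v} {w} uv uw vw i<i′)
  ... | tri≈ _ i≡i′ _ = i≡i′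
  ... | tri> _ _ i′<i = ⊥-elim (triangle-not-before {u} {w} {v} uw uv wv i′<i)

  projectClique : ∀ {m} (C : Clique (Sierpinski G t) m) (p : Fin t) →
    (∀ k l → k ≢ l → SierpinskiAdjAt G (Clique.vertex C k) (Clique.vertex C l) p) → Clique G m
  projectClique C p edgeAt = record { vertex = letter ; distinct = distinct ; adjacent = adjacent }
    where
      letter = λ k → lookup (Clique.vertex C k) p
      distinct : ∀ {k l} → letter k ≡ letter l → k ≡ l
      distinct {k} {l} same with k ≟ l
      ... | yes k≡l = k≡l
      ... | no k≢l = ⊥-elim (proj₁ (proj₂ (edgeAt k l k≢l)) same)
      adjacent : ∀ k l → k ≢ l → Adj G (letter k) (letter l)
      adjacent k l k≢l = proj₁ (proj₂ (proj₂ (edgeAt k l k≢l)))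

  module CommonPosition {m : ℕ} (C : Clique (Sierpinski G t) (suc (suc m))) where
    open Clique C

    position : ∀ k l → k ≢ l → Fin t
    position k l k≢l = proj₁ (adjacent k l k≢l)

    edge : ∀ k l (k≢l : k ≢ l) → SierpinskiAdjAt G (vertex k) (vertex l) (position k l k≢l)
    edge k l k≢l = proj₂ (adjacent k l k≢l)

    position-source : ∀ a b c (a≢b : a ≢ b) (a≢c : a ≢ c) → position a b a≢b ≡ position a c a≢c
    position-source a b c a≢b a≢c with b ≟ c
    ... | yes refl = position-unique {vertex a} {vertex b} (edge a b a≢b) (edge a b a≢c)
    ... | no b≢c = triangle-position {vertex a} {vertex b} {vertex c}
                     (edge a b a≢b) (edge a c a≢c) (edge b c b≢c) (edge c b (≢-sym b≢c))

    0≢1 : fz ≢ fs {suc m} fz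
    0≢1 ()

    common : Fin t
    common = position fz (fs fz) 0≢1

    position-common : ∀ k l (k≢l : k ≢ l) → position k l k≢l ≡ common
    position-common k l k≢l with k ≟ fz
    ... | yes refl = position-source fz l (fs fz) k≢l 0≢1
    ... | no k≢0 = begin
      position k l k≢l           ≡⟨ position-source k l fz k≢l k≢0 ⟩
      position k fz k≢0          ≡⟨ position-flip {vertex k} {vertex fz} (edge k fz k≢0) (edge fz k 0≢k) ⟩
      position fz k 0≢k          ≡⟨ position-source fz k (fs fz) 0≢k 0≢1 ⟩
      common                     ∎
      where
        open ≡-Reasoning
        0≢k = ≢-sym k≢0

    edgeAtCommon : ∀ k l → k ≢ l → SierpinskiAdjAt G (vertex k) (vertex l) common
    edgeAtCommon k l k≢l =
      subst (SierpinskiAdjAt G (vertex k) (vertex l)) (position-common k l k≢l) (edge k l k≢l)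

  -- Every clique of S(G,t) yields a clique of the same size in G
  -- (a vertex c of G supplies the cliques with fewer than two vertices).
  cliqueToBase : Fin n → ∀ m → Clique (Sierpinski G t) m → Clique G m
  cliqueToBase c zero          _ = emptyClique G
  cliqueToBase c (suc zero)    _ = singletonClique G c
  cliqueToBase c (suc (suc m)) C = projectClique C common edgeAtCommon
    where open CommonPosition C

module Embedding {n : ℕ} (G : Graph (Fin n)) (c : Fin n) where

  embed : ∀ t → Fin n → Vec (Fin n) (suc t)
  embed zero    x = x ∷ []
  embed (suc t) x = c ∷ embed t x

  embed-last : ∀ t x → lookup (embed t x) (fromℕ t) ≡ x
  embed-last zero    x = refl
  embed-last (suc t) x = embed-last t x

  embed-prefix : ∀ t x j → j < fromℕ t → lookup (embed t x) j ≡ c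
  embed-prefix (suc t) x fz     _            = refl
  embed-prefix (suc t) x (fs j) (s≤s j<last) = embed-prefix t x j j<last

  embed-injective : ∀ t {x y} → embed t x ≡ embed t y → x ≡ y
  embed-injective t {x} {y} same = begin
    x                             ≡⟨ sym (embed-last t x) ⟩
    lookup (embed t x) (fromℕ t)  ≡⟨ cong (λ w → lookup w (fromℕ t)) same ⟩
    lookup (embed t y) (fromℕ t)  ≡⟨ embed-last t y ⟩
    y                             ∎
    where open ≡-Reasoning

  embed-edge : ∀ t {x y} → x ≢ y → Adj G x y → SierpinskiAdjAt G (embed t x) (embed t y) (fromℕ t)
  embed-edge t {x} {y} x≢y xy =
      (λ j j<last → trans (embed-prefix t x j j<last) (sym (embed-prefix t y j j<last)))
    , (λ same → x≢y (trans (sym (embed-last t x)) (trans same (embed-last t y))))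
    , subst₂ (Adj G) (sym (embed-last t x)) (sym (embed-last t y)) xy
    , (λ j last<j → ⊥-elim (≤⇒≯ (≤fromℕ j) last<j))

  cliqueToSierpinski : ∀ t m → Clique G m → Clique (Sierpinski G (suc t)) m
  cliqueToSierpinski t m C = record
    { vertex = embed t ∘ vertex ; distinct = distinct ∘ embed-injective t ; adjacent = adjacent′ }
    where
      open Clique C
      adjacent′ : ∀ k l → k ≢ l → Adj (Sierpinski G (suc t)) (embed t (vertex k)) (embed t (vertex l))
      adjacent′ k l k≢l = fromℕ t , embed-edge t (k≢l ∘ distinct) (adjacent k l k≢l)

theorem7 : (n : ℕ) → 1 ≤ n → (G : Graph (Fin n)) → IsSimple G →
    (t : ℕ) → 1 ≤ t →
    (k : ℕ) → CliqueNumber (Sierpinski G t) k ⇔ CliqueNumber G k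
theorem7 (suc n) _ G _ (suc t) _ =
  cliqueNumber-transfer (Sierpinski G (suc t)) G
    (Positions.cliqueToBase G fz)
    (Embedding.cliqueToSierpinski G fz t)
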